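{- Let $G$ be a strong tricentral $2$-tree on $n$ vertices with maximum degree $\Delta$ and tail set $\{2,3\}$, and let $x$ and $y$ be the numbers of tail vertices of degree $3$ and of degree $2$, respectively. Then $x=2n-3\Delta$ and $y=3\Delta-n-3$.
   Context: A $2$-tree is a graph obtained from the triangle $K_3$ by repeatedly adding a new vertex adjacent to both endpoints of an existing edge. For $r\in\{1,2,3\}$ and an integer $\Delta\ge 2$, a $2$-tree on $n$ vertices is $r$-central with maximum degree $\Delta$ if $\Delta$ is its maximum degree and exactly $r$ vertices have degree $\Delta$; these $r$ vertices form the core and the other $n-r$ vertices form the tail. It is strong if the core induces $K_r$. It has tail set $\{2,3\}$ if every tail vertex has degree $2$ or $3$. "Tricentral" means $3$-central. -}

module Defs where

open import Data.Nat using (ℕ; zero; suc; _≤_)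
open import Data.Nat.Properties using (_≟_)
open import Data.Bool using (Bool; true; false; if_then_else_)
open import Data.Fin using (Fin; zero; suc; inject₁; fromℕ)
open import Data.List using (List; map; allFin)
open import Data.Nat.ListAction using (sum)
open import Data.Product using (_×_; Σ; ∃)
open import Data.Sum using (_⊎_)
open import Function.Bundles using (_↔_; Inverse)
open import Relation.Binary.PropositionalEquality using (_≡_; _≢_)
open import Relation.Nullary using (Dec; yes; no; ¬_)

Graph : ℕ → Set
Graph n = Fin n → Fin n → Bool

K₃ : Graph 3
K₃ i j with Data.Fin._≟_ i j
... | yes _ = false
... | no  _ = true

restrict : ∀ {n} → Graph (suc n) → Graph n
restrict G i j = G (inject₁ i) (inject₁ j)

-- 2-trees: K₃, then repeatedly add a new vertex (the last one) adjacent to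
-- exactly both endpoints of an existing edge; closed under relabelling
-- of the vertices (2-trees are an isomorphism-invariant class).
data Is2Tree : ∀ {n} → Graph n → Set where
  triangle : (G : Graph 3) → (∀ i j → G i j ≡ K₃ i j) → Is2Tree G
  extend   : ∀ {n} (G : Graph (suc n)) (u v : Fin n) →
             Is2Tree (restrict G) →
             u ≢ v → G (inject₁ u) (inject₁ v) ≡ true →
             (∀ i → G (fromℕ n) (inject₁ i) ≡ true → (i ≡ u ⊎ i ≡ v)) →
             G (fromℕ n) (inject₁ u) ≡ true →
             G (fromℕ n) (inject₁ v) ≡ true →
             (∀ i → G (inject₁ i) (fromℕ n) ≡ G (fromℕ n) (inject₁ i)) →
             G (fromℕ n) (fromℕ n) ≡ false →
             Is2Tree G
  relabel  : ∀ {n} (G H : Graph n) (σ : Fin n ↔ Fin n) →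
             Is2Tree G →
             (∀ i j → H i j ≡ G (Inverse.to σ i) (Inverse.to σ j)) →
             Is2Tree H

count : ∀ {n} {P : Fin n → Set} → (∀ i → Dec (P i)) → ℕ
count {n} P? = sum (map (λ i → if Relation.Nullary.does (P? i) then 1 else 0) (allFin n))

degree : ∀ {n} → Graph n → Fin n → ℕ
degree {n} G v = sum (map (λ w → if G v w then 1 else 0) (allFin n))

Tricentral : ∀ {n} → Graph n → ℕ → Set
Tricentral G Δ =
  (2 ≤ Δ) × (∀ v → degree G v ≤ Δ) ×
  (count (λ v → degree G v ≟ Δ) ≡ 3)

StrongCore : ∀ {n} → Graph n → ℕ → Set
StrongCore G Δ = ∀ u v → degree G u ≡ Δ → degree G v ≡ Δ → u ≢ v → G u v ≡ true

TailSet23 : ∀ {n} → Graph n → ℕ → Set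
TailSet23 G Δ = ∀ v → degree G v ≢ Δ → (degree G v ≡ 2 ⊎ degree G v ≡ 3)

tailCount : ∀ {n} → Graph n → ℕ → ℕ → ℕ
tailCount G Δ k = count (λ v → tailDec v)
  where
  open import Relation.Nullary.Decidable using (_×-dec_; ¬?)
  tailDec : ∀ v → Dec ((¬ (degree G v ≡ Δ)) × (degree G v ≡ k))
  tailDec v = ¬? (degree G v ≟ Δ) ×-dec (degree G v ≟ k)

-- A 2-tree on n vertices has 2n − 3 edges, so its degrees sum to 4n − 6.
-- Splitting the vertices into the three core vertices and the x tail
-- vertices of degree 3 and y of degree 2 gives n = 3 + x + y and
-- 4n − 6 = 3Δ + 3x + 2y, a linear system whose solution is the claim.
module Submission where

open import Defs
open import Data.Nat using (ℕ; _*_)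
open import Data.Integer using (ℤ; +_; _-_)
open import Data.Product using (_×_)
open import Relation.Binary.PropositionalEquality using (_≡_)

open import Data.Bool using (Bool; true; false; if_then_else_; not; _∧_)
open import Data.Fin using (Fin; zero; suc; inject₁; fromℕ)
import Data.Fin.Properties as Fin
open import Data.Integer using (_⊖_)
open import Data.Integer.Properties using ([+m]-[+n]≡m⊖n; ⊖-≥)
open import Data.List using (map; allFin; tabulate; _∷_; [])
open import Data.List.Properties using (map-tabulate)
import Data.Nat.ListAction as List
open import Data.Nat using (zero; suc; _+_; _∸_)
open import Data.Nat.Properties
  using (+-*-semiring; _≟_; +-identityʳ; +-cancelʳ-≡; *-suc; m≤n+m; m+n∸n≡m)
open import Data.Nat.Tactic.RingSolver using (solve-∀; solve)
open import Algebra.Properties.Semiring.Sum +-*-semiring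
  using (sum; sum-cong-≗; ∑-distrib-+; *-distribʳ-sum; sum-init-last; sum-permute; sum-replicate-zero)
open import Data.Product using (_,_)
open import Data.Sum using (_⊎_; inj₁; inj₂)
open import Function using (_∘_; _↔_; Inverse)
open import Relation.Binary.PropositionalEquality
  using (refl; sym; trans; cong; cong₂; _≢_; module ≡-Reasoning)
open import Relation.Nullary using (Dec; yes; no; does; contradiction)

indicator : Bool → ℕ
indicator b = if b then 1 else 0

sum-tabulate : ∀ {n} (f : Fin n → ℕ) → List.sum (tabulate f) ≡ sum f
sum-tabulate {zero}  f = refl
sum-tabulate {suc n} f = cong (_+_ (f zero)) (sum-tabulate (f ∘ suc))

sum-allFin : ∀ {n} (f : Fin n → ℕ) → List.sum (map f (allFin n)) ≡ sum f
sum-allFin f = trans (cong List.sum (map-tabulate (λ i → i) f)) (sum-tabulate f)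

sum-const-one : ∀ n → sum {n} (λ _ → 1) ≡ n
sum-const-one zero    = refl
sum-const-one (suc n) = cong suc (sum-const-one n)

sum-indicator-≟ : ∀ {n} (u : Fin n) → sum (λ i → indicator (does (i Fin.≟ u))) ≡ 1
sum-indicator-≟ {suc n} zero    = cong suc (sum-replicate-zero n)
sum-indicator-≟ (suc u)         = sum-indicator-≟ u

indicator-pair : ∀ {n} (b : Fin n → Bool) {u v : Fin n} → u ≢ v →
                 (∀ i → b i ≡ true → i ≡ u ⊎ i ≡ v) → b u ≡ true → b v ≡ true →
                 ∀ i → indicator (b i) ≡ indicator (does (i Fin.≟ u)) + indicator (does (i Fin.≟ v))
indicator-pair b {u} {v} u≢v only-u-v bu bv i with b i in bi | i Fin.≟ u | i Fin.≟ v
... | true  | yes refl | yes refl = contradiction refl u≢v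
... | true  | yes _    | no  _    = refl
... | true  | no  _    | yes _    = refl
... | true  | no  i≢u  | no  i≢v  with only-u-v i bi
...   | inj₁ i≡u = contradiction i≡u i≢u
...   | inj₂ i≡v = contradiction i≡v i≢v
indicator-pair b u≢v only-u-v bu bv i | false | yes refl | _        = contradiction (trans (sym bi) bu) λ ()
indicator-pair b u≢v only-u-v bu bv i | false | no  _    | yes refl = contradiction (trans (sym bi) bv) λ ()
indicator-pair b u≢v only-u-v bu bv i | false | no  _    | no  _    = refl

sum-indicator-pair : ∀ {n} (b : Fin n → Bool) {u v : Fin n} → u ≢ v →
                     (∀ i → b i ≡ true → i ≡ u ⊎ i ≡ v) → b u ≡ true → b v ≡ true →
                     sum (indicator ∘ b) ≡ 2
sum-indicator-pair b {u} {v} u≢v only-u-v bu bv = begin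
  sum (indicator ∘ b)
    ≡⟨ sum-cong-≗ (indicator-pair b u≢v only-u-v bu bv) ⟩
  sum (λ i → indicator (does (i Fin.≟ u)) + indicator (does (i Fin.≟ v)))
    ≡⟨ ∑-distrib-+ (λ i → indicator (does (i Fin.≟ u))) (λ i → indicator (does (i Fin.≟ v))) ⟩
  sum (λ i → indicator (does (i Fin.≟ u))) + sum (λ i → indicator (does (i Fin.≟ v)))
    ≡⟨ cong₂ _+_ (sum-indicator-≟ u) (sum-indicator-≟ v) ⟩
  2 ∎
  where open ≡-Reasoning

count≡sum : ∀ {n} {P : Fin n → Set} (P? : ∀ i → Dec (P i)) →
            count P? ≡ sum (λ i → indicator (does (P? i)))
count≡sum P? = sum-allFin (λ i → indicator (does (P? i)))

degree≡sum : ∀ {n} (G : Graph n) v → degree G v ≡ sum (λ w → indicator (G v w))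
degree≡sum G v = sum-allFin (λ w → indicator (G v w))

degree-cong : ∀ {n} {G H : Graph n} → (∀ i j → G i j ≡ H i j) → ∀ v → degree G v ≡ degree H v
degree-cong {G = G} {H} G≗H v = begin
  degree G v                    ≡⟨ degree≡sum G v ⟩
  sum (λ w → indicator (G v w)) ≡⟨ sum-cong-≗ (cong indicator ∘ G≗H v) ⟩
  sum (λ w → indicator (H v w)) ≡⟨ degree≡sum H v ⟨
  degree H v                    ∎
  where open ≡-Reasoning

degree-relabel : ∀ {n} (G H : Graph n) (σ : Fin n ↔ Fin n) →
                 (∀ i j → H i j ≡ G (Inverse.to σ i) (Inverse.to σ j)) →
                 ∀ v → degree H v ≡ degree G (Inverse.to σ v)
degree-relabel G H σ H≗Gσ v = begin
  degree H v                                ≡⟨ degree≡sum H v ⟩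
  sum (λ w → indicator (H v w))             ≡⟨ sum-cong-≗ (cong indicator ∘ H≗Gσ v) ⟩
  sum (λ w → indicator (G (to v) (to w)))   ≡⟨ sum-permute (λ w → indicator (G (to v) w)) σ ⟨
  sum (λ w → indicator (G (to v) w))        ≡⟨ degree≡sum G (to v) ⟨
  degree G (to v)                           ∎
  where
  open ≡-Reasoning
  to = Inverse.to σ

degree-init-last : ∀ {n} (G : Graph (suc n)) v →
                   degree G v ≡ sum (λ i → indicator (G v (inject₁ i))) + indicator (G v (fromℕ n))
degree-init-last G v = trans (degree≡sum G v) (sum-init-last (λ w → indicator (G v w)))

degreeSum : ∀ {n} → Graph n → ℕ
degreeSum G = sum (degree G)

degreeSum-restrict : ∀ {n} (G : Graph (suc n)) →
                     degreeSum G ≡ degreeSum (restrict G) + sum (λ i → indicator (G (inject₁ i) (fromℕ n)))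
                                   + degree G (fromℕ n)
degreeSum-restrict {n} G = begin
  degreeSum G
    ≡⟨ sum-init-last (degree G) ⟩
  sum (degree G ∘ inject₁) + degree G new
    ≡⟨ cong (λ s → s + degree G new) (sum-cong-≗ old-degree) ⟩
  sum (λ i → degree (restrict G) i + indicator (G (inject₁ i) new)) + degree G new
    ≡⟨ cong (λ s → s + degree G new) (∑-distrib-+ (degree (restrict G)) (λ i → indicator (G (inject₁ i) new))) ⟩
  degreeSum (restrict G) + sum (λ i → indicator (G (inject₁ i) new)) + degree G new ∎
  where
  open ≡-Reasoning
  new = fromℕ n
  old-degree : ∀ i → degree G (inject₁ i) ≡ degree (restrict G) i + indicator (G (inject₁ i) new)
  old-degree i = trans (degree-init-last G (inject₁ i))
                       (cong (λ s → s + indicator (G (inject₁ i) new)) (sym (degree≡sum (restrict G) i)))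

degreeSum-2tree : ∀ {n} {G : Graph n} → Is2Tree G → degreeSum G + 6 ≡ 4 * n
degreeSum-2tree (triangle G G≗K₃) = cong (λ s → s + 6) (sum-cong-≗ (degree-cong G≗K₃))
degreeSum-2tree (relabel G H σ G-tree H≗Gσ) = trans (cong (λ s → s + 6) relabelled) (degreeSum-2tree G-tree)
  where
  relabelled : degreeSum H ≡ degreeSum G
  relabelled = trans (sum-cong-≗ (degree-relabel G H σ H≗Gσ)) (sym (sum-permute (degree G) σ))
degreeSum-2tree (extend {n} G u v R-tree u≢v _ only-u-v new-u new-v symmetric irreflexive) = begin
  degreeSum G + 6
    ≡⟨ cong (λ s → s + 6) (degreeSum-restrict G) ⟩
  degreeSum R + sum (λ i → indicator (G (inject₁ i) new)) + degree G new + 6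
    ≡⟨ cong₂ (λ a b → degreeSum R + a + b + 6) edges-to-new degree-new ⟩
  degreeSum R + 2 + 2 + 6
    ≡⟨ regroup (degreeSum R) ⟩
  4 + (degreeSum R + 6)
    ≡⟨ cong (_+_ 4) (degreeSum-2tree R-tree) ⟩
  4 + 4 * n
    ≡⟨ *-suc 4 n ⟨
  4 * suc n ∎
  where
  open ≡-Reasoning
  new = fromℕ n
  R = restrict G
  neighbours : sum (λ i → indicator (G new (inject₁ i))) ≡ 2
  neighbours = sum-indicator-pair (λ i → G new (inject₁ i)) u≢v only-u-v new-u new-v
  edges-to-new : sum (λ i → indicator (G (inject₁ i) new)) ≡ 2
  edges-to-new = trans (sum-cong-≗ (cong indicator ∘ symmetric)) neighbours
  degree-new : degree G new ≡ 2
  degree-new = trans (degree-init-last G new) (cong₂ _+_ neighbours (cong indicator irreflexive))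
  regroup : ∀ d → d + 2 + 2 + 6 ≡ 4 + (d + 6)
  regroup = solve-∀

coreIndicator : ℕ → ℕ → ℕ
coreIndicator d Δ = indicator (does (d ≟ Δ))

tailIndicator : ℕ → ℕ → ℕ → ℕ
tailIndicator d Δ k = indicator (not (does (d ≟ Δ)) ∧ does (d ≟ k))

tailCount≡sum : ∀ {n} (G : Graph n) Δ k → tailCount G Δ k ≡ sum (λ v → tailIndicator (degree G v) Δ k)
tailCount≡sum G Δ k = sum-allFin (λ v → tailIndicator (degree G v) Δ k)

weight-split : ∀ (w : ℕ → ℕ) d Δ → (d ≢ Δ → d ≡ 2 ⊎ d ≡ 3) →
               w d ≡ coreIndicator d Δ * w Δ + tailIndicator d Δ 3 * w 3 + tailIndicator d Δ 2 * w 2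
weight-split w d Δ = split (d ≟ Δ)
  where
  split : ∀ {d Δ} (d≟Δ : Dec (d ≡ Δ)) → (d ≢ Δ → d ≡ 2 ⊎ d ≡ 3) →
          w d ≡ indicator (does d≟Δ) * w Δ + indicator (not (does d≟Δ) ∧ does (d ≟ 3)) * w 3
                + indicator (not (does d≟Δ) ∧ does (d ≟ 2)) * w 2
  split (yes refl) _ = sym (trans (+-identityʳ _) (trans (+-identityʳ _) (+-identityʳ _)))
  split (no d≢Δ) tail with tail d≢Δ
  ... | inj₁ refl = sym (+-identityʳ (w 2))
  ... | inj₂ refl = sym (trans (+-identityʳ _) (+-identityʳ (w 3)))

∑-linear₃ : ∀ {n} (f g h : Fin n → ℕ) a b c →
            sum (λ v → f v * a + g v * b + h v * c) ≡ sum f * a + sum g * b + sum h * c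
∑-linear₃ f g h a b c = begin
  sum (λ v → f v * a + g v * b + h v * c)
    ≡⟨ ∑-distrib-+ (λ v → f v * a + g v * b) (λ v → h v * c) ⟩
  sum (λ v → f v * a + g v * b) + sum (λ v → h v * c)
    ≡⟨ cong (λ s → s + sum (λ v → h v * c)) (∑-distrib-+ (λ v → f v * a) (λ v → g v * b)) ⟩
  sum (λ v → f v * a) + sum (λ v → g v * b) + sum (λ v → h v * c)
    ≡⟨ cong₂ _+_ (cong₂ _+_ (*-distribʳ-sum a f) (*-distribʳ-sum b g)) (*-distribʳ-sum c h) ⟨
  sum f * a + sum g * b + sum h * c ∎
  where open ≡-Reasoning

∑-weight∘degree : ∀ {n} (G : Graph n) Δ (w : ℕ → ℕ) → TailSet23 G Δ →
                  sum (w ∘ degree G) ≡ count (λ v → degree G v ≟ Δ) * w Δ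
                                       + tailCount G Δ 3 * w 3 + tailCount G Δ 2 * w 2
∑-weight∘degree G Δ w tail = begin
  sum (w ∘ degree G)
    ≡⟨ sum-cong-≗ (λ v → weight-split w (degree G v) Δ (tail v)) ⟩
  sum (λ v → core v * w Δ + tail₃ v * w 3 + tail₂ v * w 2)
    ≡⟨ ∑-linear₃ core tail₃ tail₂ (w Δ) (w 3) (w 2) ⟩
  sum core * w Δ + sum tail₃ * w 3 + sum tail₂ * w 2
    ≡⟨ cong₂ (λ a b → a * w Δ + b * w 3 + sum tail₂ * w 2)
             (count≡sum (λ v → degree G v ≟ Δ)) (tailCount≡sum G Δ 3) ⟨
  count (λ v → degree G v ≟ Δ) * w Δ + tailCount G Δ 3 * w 3 + sum tail₂ * w 2
    ≡⟨ cong (λ c → count (λ v → degree G v ≟ Δ) * w Δ + tailCount G Δ 3 * w 3 + c * w 2)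
            (tailCount≡sum G Δ 2) ⟨
  count (λ v → degree G v ≟ Δ) * w Δ + tailCount G Δ 3 * w 3 + tailCount G Δ 2 * w 2 ∎
  where
  open ≡-Reasoning
  core tail₃ tail₂ : Fin _ → ℕ
  core  v = coreIndicator (degree G v) Δ
  tail₃ v = tailIndicator (degree G v) Δ 3
  tail₂ v = tailIndicator (degree G v) Δ 2

solve-tail-system : ∀ {n Δ d x y} → d + 6 ≡ 4 * n → d ≡ 3 * Δ + x * 3 + y * 2 → n ≡ 3 * 1 + x * 1 + y * 1 →
                    x + 3 * Δ ≡ 2 * n × y + 3 + n ≡ 3 * Δ
solve-tail-system {n} {Δ} {d} {x} {y} handshake degrees vertices = x+3Δ≡2n , y+3+n≡3Δ
  where
  open ≡-Reasoning
  cancelled : 3 * Δ + (x * 3 + y * 2 + 6) ≡ (6 + x + 2 * y) + (x * 3 + y * 2 + 6)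
  cancelled = begin
    3 * Δ + (x * 3 + y * 2 + 6)          ≡⟨ solve (Δ ∷ x ∷ y ∷ []) ⟩
    (3 * Δ + x * 3 + y * 2) + 6          ≡⟨ cong (λ s → s + 6) degrees ⟨
    d + 6                                ≡⟨ handshake ⟩
    4 * n                                ≡⟨ cong (_*_ 4) vertices ⟩
    4 * (3 * 1 + x * 1 + y * 1)          ≡⟨ solve (x ∷ y ∷ []) ⟩
    (6 + x + 2 * y) + (x * 3 + y * 2 + 6) ∎
  3Δ : 3 * Δ ≡ 6 + x + 2 * y
  3Δ = +-cancelʳ-≡ (x * 3 + y * 2 + 6) (3 * Δ) (6 + x + 2 * y) cancelled
  x+3Δ≡2n : x + 3 * Δ ≡ 2 * n
  x+3Δ≡2n = begin
    x + 3 * Δ                    ≡⟨ cong (_+_ x) 3Δ ⟩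
    x + (6 + x + 2 * y)          ≡⟨ solve (x ∷ y ∷ []) ⟩
    2 * (3 * 1 + x * 1 + y * 1)  ≡⟨ cong (_*_ 2) vertices ⟨
    2 * n                        ∎
  y+3+n≡3Δ : y + 3 + n ≡ 3 * Δ
  y+3+n≡3Δ = begin
    y + 3 + n                          ≡⟨ cong (_+_ (y + 3)) vertices ⟩
    y + 3 + (3 * 1 + x * 1 + y * 1)    ≡⟨ solve (x ∷ y ∷ []) ⟩
    6 + x + 2 * y                      ≡⟨ 3Δ ⟨
    3 * Δ                              ∎

m+n≡o⇒+m≡+o-+n : ∀ {m n o} → m + n ≡ o → + m ≡ + o - + n
m+n≡o⇒+m≡+o-+n {m} {n} refl = begin
  + m               ≡⟨ cong +_ (m+n∸n≡m m n) ⟨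
  + (m + n ∸ n)     ≡⟨ ⊖-≥ (m≤n+m n m) ⟨
  (m + n) ⊖ n       ≡⟨ [+m]-[+n]≡m⊖n (m + n) n ⟨
  + (m + n) - + n   ∎
  where open ≡-Reasoning

lemma5p1 : (n Δ : ℕ) (G : Graph n) →
    Is2Tree G → Tricentral G Δ → StrongCore G Δ → TailSet23 G Δ →
    ((+ tailCount G Δ 3) ≡ (+ (2 * n)) - (+ (3 * Δ))) ×
    ((+ tailCount G Δ 2) ≡ (+ (3 * Δ)) - (+ n) - (+ 3))
lemma5p1 n Δ G tree (_ , _ , core≡3) _ tail =
  let x+3Δ≡2n , y+3+n≡3Δ = solve-tail-system {Δ = Δ} {x = x} {y = y} (degreeSum-2tree tree) degrees vertices
  in  m+n≡o⇒+m≡+o-+n x+3Δ≡2n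
    , trans (m+n≡o⇒+m≡+o-+n {y} {3} refl) (cong (λ z → z - + 3) (m+n≡o⇒+m≡+o-+n {y + 3} {n} y+3+n≡3Δ))
  where
  x = tailCount G Δ 3
  y = tailCount G Δ 2
  degrees : degreeSum G ≡ 3 * Δ + x * 3 + y * 2
  degrees = trans (∑-weight∘degree G Δ (λ d → d) tail) (cong (λ c → c * Δ + x * 3 + y * 2) core≡3)
  vertices : n ≡ 3 * 1 + x * 1 + y * 1
  vertices = trans (sym (sum-const-one n))
                   (trans (∑-weight∘degree G Δ (λ _ → 1) tail) (cong (λ c → c * 1 + x * 1 + y * 1) core≡3))
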